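{- Let $n\ge 1$, $k\ge 1$ and $\alpha=(a_1,\dots,a_n)\in PF_{n,k}$. Then $u_\alpha(j)\le k$ for all $j\in[n]$.
   Context: $[n]=\{1,\dots,n\}$. A parking preference of length $n$ is $\alpha=(a_1,\dots,a_n)\in[n]^n$; $PP_n=[n]^n$. Cars $c_1,\dots,c_n$ arrive in this order at a one-way street with spots $1,\dots,n$; car $c_i$ has preference $a_i$. Under the $k$-Naples parking rule ($k\ge1$), car $c_i$ drives to spot $a_i$ and parks there if it is free; otherwise it checks spots $a_i-1,a_i-2,\dots,a_i-k$ (only those that are $\ge 1$) in this order and parks in the first free one; if none is free it drives forward and parks in the first free spot $j>a_i$, and fails to park if there is none. $PF_{n,k}$ is the set of $\alpha\in PP_n$ for which all cars park under the $k$-Naples rule. For $\alpha\in PP_n$ let $|\alpha|_i=|\{j\in[n]: a_j=i\}|$ and for $j\in[n]$ let $u_\alpha(j)=\sum_{i=j}^n|\alpha|_i-(n-j+1)$. -}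

module Defs where

open import Data.Nat using (ℕ; zero; suc; _+_; _∸_; _≤_; _≟_)
open import Data.Bool using (Bool; true; false; if_then_else_; not)
open import Data.List using (List; []; _∷_; replicate; filter; length)
open import Data.Maybe using (Maybe; just; nothing; Is-just)
open import Data.Vec using (Vec; toList)
open import Data.Vec.Relation.Unary.All using (All)
open import Data.Product using (_×_)
open import Data.Integer using (ℤ; +_; _-_)
open import Relation.Nullary.Decidable using (does)

-- A street state: list of Booleans, entry at index (j-1) is true iff spot j is occupied.

isFree : List Bool → ℕ → Bool
isFree occ zero = false
isFree [] (suc i) = false
isFree (b ∷ occ) (suc zero) = not b
isFree (b ∷ occ) (suc (suc i)) = isFree occ (suc i)

occupy : List Bool → ℕ → List Bool
occupy occ zero = occ
occupy [] (suc i) = []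
occupy (b ∷ occ) (suc zero) = true ∷ occ
occupy (b ∷ occ) (suc (suc i)) = b ∷ occupy occ (suc i)

backSearch : List Bool → ℕ → ℕ → Maybe ℕ
backSearch occ a zero = nothing
backSearch occ zero (suc m) = nothing
backSearch occ (suc b) (suc m) = if isFree occ b then just b else backSearch occ b m

fwdSearch : List Bool → ℕ → ℕ → Maybe ℕ
fwdSearch occ j zero = nothing
fwdSearch occ j (suc fuel) = if isFree occ j then just j else fwdSearch occ (suc j) fuel

-- Spot taken by a car with preference a under the k-Naples rule (nothing = fails to park).
-- Forward search from a+1 with fuel = length of street covers all spots j > a.
naplesSpot : ℕ → List Bool → ℕ → Maybe ℕ
naplesSpot k occ a with isFree occ a
... | true = just a
... | false with backSearch occ a k
...   | just s = just s
...   | nothing = fwdSearch occ (suc a) (length occ)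

naplesRun : ℕ → List Bool → List ℕ → Maybe (List Bool)
naplesRun k occ [] = just occ
naplesRun k occ (a ∷ as) with naplesSpot k occ a
... | nothing = nothing
... | just s = naplesRun k (occupy occ s) as

IsPP : (n : ℕ) → Vec ℕ n → Set
IsPP n α = All (λ a → 1 ≤ a × a ≤ n) α

IsPF : (n k : ℕ) → Vec ℕ n → Set
IsPF n k α = IsPP n α × Is-just (naplesRun k (replicate n false) (toList α))

mult : {n : ℕ} → Vec ℕ n → ℕ → ℕ
mult α i = length (filter (λ a → a ≟ i) (toList α))

-- Σ_{i=j}^{n} |α|_i, computed as Σ over i = j, j+1, ..., j+(cnt-1) with cnt = n - j + 1
sumMult : {n : ℕ} → Vec ℕ n → ℕ → ℕ → ℕ
sumMult α j zero = 0
sumMult α j (suc cnt) = mult α j + sumMult α (suc j) cnt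

u : (n : ℕ) → Vec ℕ n → ℕ → ℤ
u n α j = + sumMult α j (n ∸ j + 1) - + (n ∸ j + 1)

{-# OPTIONS --safe #-}
-- The sum of |α|_i over i ≥ j is the number of cars with preference ≥ j. Under the k-Naples
-- rule a car with preference a ends up in a spot s with a ≤ k + s, so these cars occupy distinct
-- spots beyond j − (k + 1), of which there are at most (n − j + 1) + k.
module Submission where

open import Defs
open import Data.Nat using (ℕ; zero; suc; _+_; _∸_; _≤_; _<_; z≤n; s≤s; z<s; _≟_; _≤?_)
open import Data.Nat.Properties
open import Data.Nat.Tactic.RingSolver using (solve-∀)
open import Data.Bool using (Bool; true; false)
open import Data.List using (List; []; _∷_; length; filter; drop; replicate)
open import Data.List.Properties using (filter-accept; filter-reject; length-filter; length-drop; length-replicate)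
open import Data.Maybe using (just; nothing)
open import Data.Vec using (Vec; toList)
open import Data.Product using (_×_; _,_)
open import Data.Integer using (+_)
import Data.Integer as ℤ
import Data.Integer.Properties as ℤ
open import Relation.Nullary.Decidable using (T?; yes; no)
open import Relation.Binary.Definitions using (tri<; tri≈; tri>)
open import Relation.Binary.PropositionalEquality using (_≡_; refl; trans; cong)

countAtLeast : ℕ → List ℕ → ℕ
countAtLeast j xs = length (filter (j ≤?_) xs)

countAtLeast-split : ∀ j xs →
  length (filter (_≟ j) xs) + countAtLeast (suc j) xs ≡ countAtLeast j xs
countAtLeast-split j [] = refl
countAtLeast-split j (x ∷ xs) with <-cmp x j
... | tri< x<j x≢j _
  rewrite filter-reject (_≟ j) {xs = xs} x≢j
        | filter-reject (suc j ≤?_) {xs = xs} (<⇒≱ (m<n⇒m<1+n x<j))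
        | filter-reject (j ≤?_) {xs = xs} (<⇒≱ x<j)
  = countAtLeast-split j xs
... | tri≈ _ refl _
  rewrite filter-accept (_≟ j) {xs = xs} refl
        | filter-reject (suc j ≤?_) {xs = xs} (<-irrefl refl)
        | filter-accept (j ≤?_) {xs = xs} ≤-refl
  = cong suc (countAtLeast-split j xs)
... | tri> _ x≢j j<x
  rewrite filter-reject (_≟ j) {xs = xs} x≢j
        | filter-accept (suc j ≤?_) {xs = xs} j<x
        | filter-accept (j ≤?_) {xs = xs} (<⇒≤ j<x)
  = trans (+-suc _ _) (cong suc (countAtLeast-split j xs))

sumMult≤countAtLeast : ∀ {n} (α : Vec ℕ n) j c → sumMult α j c ≤ countAtLeast j (toList α)
sumMult≤countAtLeast α j zero = z≤n
sumMult≤countAtLeast α j (suc c) =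
  ≤-trans (+-monoʳ-≤ (mult α j) (sumMult≤countAtLeast α (suc j) c))
          (≤-reflexive (countAtLeast-split j (toList α)))

fwdSearch-sound : ∀ occ j f {s} → fwdSearch occ j f ≡ just s → isFree occ s ≡ true × j ≤ s
fwdSearch-sound occ j (suc f) eq with isFree occ j in free
fwdSearch-sound occ j (suc f) refl | true = free , ≤-refl
... | false with fwdSearch-sound occ (suc j) f eq
... | free′ , j<s = free′ , <⇒≤ j<s

backSearch-sound : ∀ occ a m {s} → backSearch occ a m ≡ just s → isFree occ s ≡ true × a ≤ m + s
backSearch-sound occ (suc b) (suc m) eq with isFree occ b in free
backSearch-sound occ (suc b) (suc m) refl | true = free , s≤s (m≤n+m b m)
... | false with backSearch-sound occ b m eq
... | free′ , b≤m+s = free′ , s≤s b≤m+s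

naplesSpot-sound : ∀ k occ a {s} → naplesSpot k occ a ≡ just s → isFree occ s ≡ true × a ≤ k + s
naplesSpot-sound k occ a eq with isFree occ a in free
naplesSpot-sound k occ a refl | true = free , m≤n+m a k
... | false with backSearch occ a k in back
naplesSpot-sound k occ a refl | false | just _ = backSearch-sound occ a k back
... | nothing with fwdSearch-sound occ (suc a) (length occ) eq
... | free′ , a<s = free′ , ≤-trans (<⇒≤ a<s) (m≤n+m _ k)

freeSpot-beyond : ∀ occ {j k a s} → isFree occ s ≡ true → j ≤ a → a ≤ k + s → j ∸ suc k < s
freeSpot-beyond occ {j} {k} {s = suc _} _ j≤a a≤k+s = m<n+o⇒m∸n<o j (suc k) (s≤s (≤-trans j≤a a≤k+s))

occupiedCount : List Bool → ℕ
occupiedCount occ = length (filter T? occ)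

-- drop d occ is the part of the street beyond spot d.
occupy-free-drop : ∀ occ d {s} → isFree occ s ≡ true → d < s →
  occupiedCount (drop d (occupy occ s)) ≡ suc (occupiedCount (drop d occ))
occupy-free-drop (false ∷ occ) zero {suc zero} _ _ = refl
occupy-free-drop (true ∷ occ) zero {suc (suc i)} free _ = cong suc (occupy-free-drop occ zero free z<s)
occupy-free-drop (false ∷ occ) zero {suc (suc i)} free _ = occupy-free-drop occ zero free z<s
occupy-free-drop (_ ∷ occ) (suc d) {suc (suc i)} free (s≤s d<s) = occupy-free-drop occ d free d<s

occupy-mono-drop : ∀ occ d s → occupiedCount (drop d occ) ≤ occupiedCount (drop d (occupy occ s))
occupy-mono-drop occ d zero = ≤-refl
occupy-mono-drop [] d (suc i) = ≤-refl
occupy-mono-drop (true ∷ occ) zero (suc zero) = ≤-refl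
occupy-mono-drop (false ∷ occ) zero (suc zero) = n≤1+n _
occupy-mono-drop (_ ∷ occ) (suc d) (suc zero) = ≤-refl
occupy-mono-drop (true ∷ occ) zero (suc (suc i)) = s≤s (occupy-mono-drop occ zero (suc i))
occupy-mono-drop (false ∷ occ) zero (suc (suc i)) = occupy-mono-drop occ zero (suc i)
occupy-mono-drop (_ ∷ occ) (suc d) (suc (suc i)) = occupy-mono-drop occ d (suc i)

length-occupy : ∀ occ s → length (occupy occ s) ≡ length occ
length-occupy occ zero = refl
length-occupy [] (suc i) = refl
length-occupy (_ ∷ occ) (suc zero) = refl
length-occupy (_ ∷ occ) (suc (suc i)) = cong suc (length-occupy occ (suc i))

naplesRun-length : ∀ k occ as {occ′} → naplesRun k occ as ≡ just occ′ → length occ′ ≡ length occ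
naplesRun-length k occ [] refl = refl
naplesRun-length k occ (a ∷ as) eq with naplesSpot k occ a
... | just s = trans (naplesRun-length k (occupy occ s) as eq) (length-occupy occ s)

naplesRun-fillsBeyond : ∀ k j occ as {occ′} → naplesRun k occ as ≡ just occ′ →
  occupiedCount (drop (j ∸ suc k) occ) + countAtLeast j as ≤ occupiedCount (drop (j ∸ suc k) occ′)
naplesRun-fillsBeyond k j occ [] refl = ≤-reflexive (+-identityʳ _)
naplesRun-fillsBeyond k j occ (a ∷ as) {occ′} eq with naplesSpot k occ a in spot
... | just s with naplesSpot-sound k occ a spot | j ≤? a
... | free , a≤k+s | yes j≤a = begin
  occupiedCount (drop d occ) + countAtLeast j (a ∷ as)
    ≡⟨ cong (λ t → occupiedCount (drop d occ) + length t) (filter-accept (j ≤?_) j≤a) ⟩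
  occupiedCount (drop d occ) + suc (countAtLeast j as)
    ≡⟨ +-suc _ _ ⟩
  suc (occupiedCount (drop d occ)) + countAtLeast j as
    ≡⟨ cong (_+ countAtLeast j as) (occupy-free-drop occ d free (freeSpot-beyond occ free j≤a a≤k+s)) ⟨
  occupiedCount (drop d (occupy occ s)) + countAtLeast j as
    ≤⟨ naplesRun-fillsBeyond k j (occupy occ s) as eq ⟩
  occupiedCount (drop d occ′) ∎
  where
  open ≤-Reasoning
  d = j ∸ suc k
... | _ | no j≰a = begin
  occupiedCount (drop d occ) + countAtLeast j (a ∷ as)
    ≡⟨ cong (λ t → occupiedCount (drop d occ) + length t) (filter-reject (j ≤?_) j≰a) ⟩
  occupiedCount (drop d occ) + countAtLeast j as
    ≤⟨ +-monoˡ-≤ (countAtLeast j as) (occupy-mono-drop occ d s) ⟩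
  occupiedCount (drop d (occupy occ s)) + countAtLeast j as
    ≤⟨ naplesRun-fillsBeyond k j (occupy occ s) as eq ⟩
  occupiedCount (drop d occ′) ∎
  where
  open ≤-Reasoning
  d = j ∸ suc k

n∸[j∸1+k]≤[n∸j+1]+k : ∀ {n} j k → j ≤ n → n ∸ (j ∸ suc k) ≤ (n ∸ j + 1) + k
n∸[j∸1+k]≤[n∸j+1]+k {n} j k j≤n = m≤n+o⇒m∸n≤o n (j ∸ suc k) (begin
  n                                       ≡⟨ m+[n∸m]≡n j≤n ⟨
  j + (n ∸ j)                             ≤⟨ +-monoˡ-≤ (n ∸ j) (m≤n+m∸n j (suc k)) ⟩
  suc k + (j ∸ suc k) + (n ∸ j)           ≡⟨ rearrange k (j ∸ suc k) (n ∸ j) ⟩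
  (j ∸ suc k) + ((n ∸ j + 1) + k)         ∎)
  where
  open ≤-Reasoning
  rearrange : ∀ k x y → suc k + x + y ≡ x + ((y + 1) + k)
  rearrange = solve-∀

m≤n+o⇒+m-+n≤+o : ∀ {m n o} → m ≤ n + o → + m ℤ.- + n ℤ.≤ + o
m≤n+o⇒+m-+n≤+o {m} {n} {o} m≤n+o = begin
  + m ℤ.- + n       ≡⟨ ℤ.[+m]-[+n]≡m⊖n m n ⟩
  m ℤ.⊖ n           ≤⟨ ℤ.⊖-monoˡ-≤ n m≤n+o ⟩
  (n + o) ℤ.⊖ n     ≡⟨ ℤ.⊖-≥ (m≤m+n n o) ⟩
  + (n + o ∸ n)     ≡⟨ cong +_ (m+n∸m≡n n o) ⟩
  + o               ∎
  where open ℤ.≤-Reasoning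

mainTheorem1 : (n k : ℕ) → 1 ≤ n → 1 ≤ k → (α : Vec ℕ n) → IsPF n k α →
    (j : ℕ) → 1 ≤ j → j ≤ n → u n α j ℤ.≤ + k
mainTheorem1 n k _ _ α (_ , parks) j _ j≤n
  with naplesRun k (replicate n false) (toList α) in run | parks
... | just occ′ | _ = m≤n+o⇒+m-+n≤+o (begin
  sumMult α j (n ∸ j + 1)        ≤⟨ sumMult≤countAtLeast α j (n ∸ j + 1) ⟩
  countAtLeast j (toList α)      ≤⟨ m+n≤o⇒n≤o _ (naplesRun-fillsBeyond k j _ (toList α) run) ⟩
  occupiedCount (drop d occ′)    ≤⟨ length-filter T? (drop d occ′) ⟩
  length (drop d occ′)           ≡⟨ length-drop d occ′ ⟩
  length occ′ ∸ d                ≡⟨ cong (_∸ d) (trans (naplesRun-length k _ (toList α) run) (length-replicate n)) ⟩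
  n ∸ d                          ≤⟨ n∸[j∸1+k]≤[n∸j+1]+k j k j≤n ⟩
  (n ∸ j + 1) + k                ∎)
  where
  open ≤-Reasoning
  d = j ∸ suc k
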